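{- Let $L$ be a residuated lattice, $n\geq 1$ an integer, and $F$ a filter of $L$. Then $F$ is an $n$-fold positive implicative filter of $L$ if and only if $F$ is both an $n$-fold fantastic filter and an $n$-fold implicative filter of $L$.
   Context: A residuated lattice is an algebra $(L,\wedge,\vee,\otimes,\rightarrow,0,1)$ such that $(L,\wedge,\vee,0,1)$ is a bounded lattice, $(L,\otimes,1)$ is a commutative monoid, and $x\otimes y\leq z$ iff $x\leq y\rightarrow z$. A filter of $L$ is a nonempty subset closed under $\otimes$ and upward closed. For $x\in L$, $x^n=x\otimes\cdots\otimes x$ ($n$ factors). A subset $F\subseteq L$ is: - an $n$-fold positive implicative filter if $1\in F$ and for all $x,y,z\in L$: $x\rightarrow((y^n\rightarrow z)\rightarrow y)\in F$ and $x\in F$ imply $y\in F$; - an $n$-fold implicative filter if $1\in F$ and for all $x,y,z\in L$: $x^n\rightarrow(y\rightarrow z)\in F$ and $x^n\rightarrow y\in F$ imply $x^n\rightarrow z\in F$; - an $n$-fold fantastic filter if $1\in F$ and for all $x,y\in L$: $y\rightarrow x\in F$ implies $((x^n\rightarrow y)\rightarrow y)\rightarrow x\in F$. -}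

module Defs where

open import Level using (Level; suc; _⊔_)
open import Data.Nat using (ℕ; zero) renaming (suc to sucℕ)
open import Data.Product using (_×_; ∃-syntax)
open import Relation.Binary.PropositionalEquality using (_≡_)
open import Relation.Unary using (Pred; _∈_)

record ResiduatedLattice (a : Level) : Set (suc a) where
  infixr 6 _∨_
  infixr 7 _∧_
  infixr 8 _⊗_
  infixr 5 _⇒_
  infix 4 _≤_
  field
    Carrier : Set a
    _∧_ _∨_ _⊗_ _⇒_ : Carrier → Carrier → Carrier
    𝟘 𝟙 : Carrier
    ∧-comm  : ∀ x y → x ∧ y ≡ y ∧ x
    ∨-comm  : ∀ x y → x ∨ y ≡ y ∨ x
    ∧-assoc : ∀ x y z → (x ∧ y) ∧ z ≡ x ∧ (y ∧ z)
    ∨-assoc : ∀ x y z → (x ∨ y) ∨ z ≡ x ∨ (y ∨ z)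
    ∧-absorbs-∨ : ∀ x y → x ∧ (x ∨ y) ≡ x
    ∨-absorbs-∧ : ∀ x y → x ∨ (x ∧ y) ≡ x
    ∧-zero : ∀ x → 𝟘 ∧ x ≡ 𝟘
    ∧-one  : ∀ x → 𝟙 ∧ x ≡ x
    ⊗-comm     : ∀ x y → x ⊗ y ≡ y ⊗ x
    ⊗-assoc    : ∀ x y z → (x ⊗ y) ⊗ z ≡ x ⊗ (y ⊗ z)
    ⊗-identity : ∀ x → x ⊗ 𝟙 ≡ x

  _≤_ : Carrier → Carrier → Set a
  x ≤ y = x ∧ y ≡ x

  field
    residuation₁ : ∀ x y z → x ⊗ y ≤ z → x ≤ y ⇒ z
    residuation₂ : ∀ x y z → x ≤ y ⇒ z → x ⊗ y ≤ z

  -- x ^ n = x ⊗ ⋯ ⊗ x (n factors); for n = 0 this is 𝟙 (only used for n ≥ 1)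
  _^_ : Carrier → ℕ → Carrier
  x ^ zero = 𝟙
  x ^ sucℕ zero = x
  x ^ sucℕ (sucℕ n) = x ⊗ (x ^ sucℕ n)

module _ {a : Level} (L : ResiduatedLattice a) where
  open ResiduatedLattice L

  record IsFilter {ℓ : Level} (F : Pred Carrier ℓ) : Set (a ⊔ ℓ) where
    field
      nonempty : ∃[ x ] (x ∈ F)
      ⊗-closed : ∀ {x y} → x ∈ F → y ∈ F → x ⊗ y ∈ F
      up-closed : ∀ {x y} → x ≤ y → x ∈ F → y ∈ F

  IsNFoldPositiveImplicative : {ℓ : Level} → ℕ → Pred Carrier ℓ → Set (a ⊔ ℓ)
  IsNFoldPositiveImplicative n F =
    (𝟙 ∈ F) ×
    (∀ x y z → (x ⇒ ((y ^ n ⇒ z) ⇒ y)) ∈ F → x ∈ F → y ∈ F)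

  IsNFoldImplicative : {ℓ : Level} → ℕ → Pred Carrier ℓ → Set (a ⊔ ℓ)
  IsNFoldImplicative n F =
    (𝟙 ∈ F) ×
    (∀ x y z → (x ^ n ⇒ (y ⇒ z)) ∈ F → (x ^ n ⇒ y) ∈ F → (x ^ n ⇒ z) ∈ F)

  IsNFoldFantastic : {ℓ : Level} → ℕ → Pred Carrier ℓ → Set (a ⊔ ℓ)
  IsNFoldFantastic n F =
    (𝟙 ∈ F) ×
    (∀ x y → (y ⇒ x) ∈ F → (((x ^ n ⇒ y) ⇒ y) ⇒ x) ∈ F)

-- A filter F is n-fold positive implicative exactly when (y ^ n ⇒ z) ⇒ y ∈ F
-- forces y ∈ F. Applied to y = x ^ n ⇒ x ⊗ x ^ n and z = 𝟘 this makes every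
-- power x ^ n idempotent modulo F, i.e. x ^ n ⇒ x ^ n ⊗ x ^ n ∈ F, which is
-- precisely what lets x ^ n be used twice in a modus ponens: the implicative
-- law. Applied to w = ((x ^ n ⇒ y) ⇒ y) ⇒ x, which lies above x, it gives the
-- fantastic law.
-- Conversely, from (y ^ n ⇒ z) ⇒ y ∈ F the fantastic law yields
-- ((y ^ n ⇒ s) ⇒ s) ⇒ y ∈ F with s = y ^ n ⇒ z, and the implicative law
-- contracts y ^ n ⇒ (y ^ n ⇒ z) to s, so that modus ponens gives y ∈ F.
module Submission where

open import Defs
open import Level using (Level; _⊔_)
open import Data.Nat using (ℕ; _≥_; zero; suc)
open import Data.Product using (_×_; _,_)
open import Function.Bundles using (_⇔_; mk⇔; module Equivalence)
open import Relation.Unary using (Pred; _∈_)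
open import Relation.Binary.Bundles using (Poset)
open import Relation.Binary.PropositionalEquality
  using (_≡_; refl; sym; trans; cong; cong₂; subst; isEquivalence)
open import Algebra.Bundles using (CommutativeSemigroup)
import Algebra.Properties.CommutativeSemigroup as CommutativeSemigroupProperties
import Relation.Binary.Reasoning.PartialOrder as PartialOrderReasoning

module ResiduatedLatticeProperties {a : Level} (L : ResiduatedLattice a) where
  open ResiduatedLattice L

  ≤-reflexive : ∀ {x y} → x ≡ y → x ≤ y
  ≤-reflexive {x} refl = trans (cong (x ∧_) (sym (∨-absorbs-∧ x x))) (∧-absorbs-∨ x (x ∧ x))

  ≤-refl : ∀ {x} → x ≤ x
  ≤-refl = ≤-reflexive refl

  ≤-trans : ∀ {x y z} → x ≤ y → y ≤ z → x ≤ z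
  ≤-trans {x} {y} {z} x≤y y≤z =
    trans (cong (_∧ z) (sym x≤y)) (trans (∧-assoc x y z) (trans (cong (x ∧_) y≤z) x≤y))

  ≤-antisym : ∀ {x y} → x ≤ y → y ≤ x → x ≡ y
  ≤-antisym {x} {y} x≤y y≤x = trans (sym x≤y) (trans (∧-comm x y) y≤x)

  ≤-poset : Poset a a a
  ≤-poset = record
    { Carrier = Carrier
    ; _≈_ = _≡_
    ; _≤_ = _≤_
    ; isPartialOrder = record
      { isPreorder = record
        { isEquivalence = isEquivalence
        ; reflexive = ≤-reflexive
        ; trans = ≤-trans
        }
      ; antisym = ≤-antisym
      }
    }

  ⊗-commutativeSemigroup : CommutativeSemigroup a a
  ⊗-commutativeSemigroup = record
    { Carrier = Carrier
    ; _≈_ = _≡_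
    ; _∙_ = _⊗_
    ; isCommutativeSemigroup = record
      { isSemigroup = record
        { isMagma = record { isEquivalence = isEquivalence ; ∙-cong = cong₂ _⊗_ }
        ; assoc = ⊗-assoc
        }
      ; comm = ⊗-comm
      }
    }

  open PartialOrderReasoning ≤-poset
  open CommutativeSemigroupProperties ⊗-commutativeSemigroup
    using (interchange; xy∙z≈y∙xz; x∙yz≈y∙xz; xy∙z≈xz∙y)

  ≤-𝟙 : ∀ {x} → x ≤ 𝟙
  ≤-𝟙 {x} = trans (∧-comm x 𝟙) (∧-one x)

  𝟘-≤ : ∀ {x} → 𝟘 ≤ x
  𝟘-≤ {x} = ∧-zero x

  ⊗-identityˡ : ∀ x → 𝟙 ⊗ x ≡ x
  ⊗-identityˡ x = trans (⊗-comm 𝟙 x) (⊗-identity x)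

  curry : ∀ {x y z} → x ⊗ y ≤ z → x ≤ y ⇒ z
  curry = residuation₁ _ _ _

  uncurry : ∀ {x y z} → x ≤ y ⇒ z → x ⊗ y ≤ z
  uncurry = residuation₂ _ _ _

  eval : ∀ {x y} → (x ⇒ y) ⊗ x ≤ y
  eval = uncurry ≤-refl

  ⊗-monoˡ-≤ : ∀ {x y} z → x ≤ y → x ⊗ z ≤ y ⊗ z
  ⊗-monoˡ-≤ z x≤y = uncurry (≤-trans x≤y (curry ≤-refl))

  ⊗-monoʳ-≤ : ∀ {x y} z → x ≤ y → z ⊗ x ≤ z ⊗ y
  ⊗-monoʳ-≤ {x} {y} z x≤y = begin
    z ⊗ x  ≡⟨ ⊗-comm z x ⟩
    x ⊗ z  ≤⟨ ⊗-monoˡ-≤ z x≤y ⟩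
    y ⊗ z  ≡⟨ ⊗-comm y z ⟩
    z ⊗ y  ∎

  ^-suc : ∀ x k → x ^ suc k ≡ x ⊗ x ^ k
  ^-suc x zero = sym (⊗-identity x)
  ^-suc x (suc k) = refl

  ^-mono-≤ : ∀ {x y} k → x ≤ y → x ^ k ≤ y ^ k
  ^-mono-≤ zero x≤y = ≤-refl
  ^-mono-≤ {x} {y} (suc k) x≤y = begin
    x ^ suc k    ≡⟨ ^-suc x k ⟩
    x ⊗ x ^ k    ≤⟨ ⊗-monoˡ-≤ (x ^ k) x≤y ⟩
    y ⊗ x ^ k    ≤⟨ ⊗-monoʳ-≤ y (^-mono-≤ k x≤y) ⟩
    y ⊗ y ^ k    ≡⟨ ^-suc y k ⟨
    y ^ suc k    ∎

  ≤-⇒ : ∀ {x y} → x ≤ y ⇒ x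
  ≤-⇒ {x} {y} = curry (≤-trans (⊗-monoʳ-≤ x ≤-𝟙) (≤-reflexive (⊗-identity x)))

  ⇒-antitoneˡ : ∀ {x y} z → x ≤ y → y ⇒ z ≤ x ⇒ z
  ⇒-antitoneˡ z x≤y = curry (≤-trans (⊗-monoʳ-≤ _ x≤y) eval)

  ⇒-monotoneʳ : ∀ {y z} x → y ≤ z → x ⇒ y ≤ x ⇒ z
  ⇒-monotoneʳ x y≤z = curry (≤-trans eval y≤z)

  ⇒-compose : ∀ {x y z} → (x ⇒ y) ⊗ (y ⇒ z) ≤ x ⇒ z
  ⇒-compose {x} {y} {z} = curry (begin
    ((x ⇒ y) ⊗ (y ⇒ z)) ⊗ x  ≡⟨ xy∙z≈y∙xz (x ⇒ y) (y ⇒ z) x ⟩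
    (y ⇒ z) ⊗ ((x ⇒ y) ⊗ x)  ≤⟨ ⊗-monoʳ-≤ (y ⇒ z) eval ⟩
    (y ⇒ z) ⊗ y              ≤⟨ eval ⟩
    z                        ∎)

  ⇒-⊗-monoˡ : ∀ {x y} w → x ⇒ y ≤ (w ⊗ x) ⇒ (w ⊗ y)
  ⇒-⊗-monoˡ {x} {y} w = curry (begin
    (x ⇒ y) ⊗ (w ⊗ x)  ≡⟨ x∙yz≈y∙xz (x ⇒ y) w x ⟩
    w ⊗ ((x ⇒ y) ⊗ x)  ≤⟨ ⊗-monoʳ-≤ w eval ⟩
    w ⊗ y              ∎)

  ⇒-contract : ∀ {x y z} → (x ⇒ (y ⇒ z)) ⊗ (x ⇒ y) ≤ (x ⊗ x) ⇒ z
  ⇒-contract {x} {y} {z} = curry (begin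
    ((x ⇒ (y ⇒ z)) ⊗ (x ⇒ y)) ⊗ (x ⊗ x)  ≡⟨ interchange (x ⇒ (y ⇒ z)) (x ⇒ y) x x ⟩
    ((x ⇒ (y ⇒ z)) ⊗ x) ⊗ ((x ⇒ y) ⊗ x)  ≤⟨ ⊗-monoˡ-≤ _ eval ⟩
    (y ⇒ z) ⊗ ((x ⇒ y) ⊗ x)              ≤⟨ ⊗-monoʳ-≤ (y ⇒ z) eval ⟩
    (y ⇒ z) ⊗ y                          ≤⟨ eval ⟩
    z                                    ∎)

  ⇒-exchange : ∀ {x y z} → x ⇒ (y ⇒ z) ≤ y ⇒ (x ⇒ z)
  ⇒-exchange {x} {y} {z} = curry (curry (begin
    ((x ⇒ (y ⇒ z)) ⊗ y) ⊗ x  ≡⟨ xy∙z≈xz∙y (x ⇒ (y ⇒ z)) y x ⟩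
    ((x ⇒ (y ⇒ z)) ⊗ x) ⊗ y  ≤⟨ ⊗-monoˡ-≤ y eval ⟩
    (y ⇒ z) ⊗ y              ≤⟨ eval ⟩
    z                        ∎))

module FilterProperties {a ℓ : Level} (L : ResiduatedLattice a)
  {F : Pred (ResiduatedLattice.Carrier L) ℓ} (isFilter : IsFilter L F) where
  open ResiduatedLattice L
  open IsFilter isFilter
  open ResiduatedLatticeProperties L
  open PartialOrderReasoning ≤-poset
  open CommutativeSemigroupProperties ⊗-commutativeSemigroup using (xy∙z≈x∙zy)

  𝟙∈F : 𝟙 ∈ F
  𝟙∈F = let (x , x∈F) = nonempty in up-closed ≤-𝟙 x∈F

  ≤⇒⇒∈ : ∀ {x y} → x ≤ y → (x ⇒ y) ∈ F
  ≤⇒⇒∈ {x} x≤y = up-closed (curry (≤-trans (≤-reflexive (⊗-identityˡ x)) x≤y)) 𝟙∈F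

  modus-ponens : ∀ {x y} → x ∈ F → (x ⇒ y) ∈ F → y ∈ F
  modus-ponens {x} {y} x∈F x⇒y∈F =
    up-closed (≤-trans (≤-reflexive (⊗-comm x (x ⇒ y))) eval) (⊗-closed x∈F x⇒y∈F)

  ⇒-trans-∈ : ∀ {x y z} → (x ⇒ y) ∈ F → (y ⇒ z) ∈ F → (x ⇒ z) ∈ F
  ⇒-trans-∈ x⇒y∈F y⇒z∈F = up-closed ⇒-compose (⊗-closed x⇒y∈F y⇒z∈F)

  ⇒-⊗-iterate-∈ : ∀ {x w} → (w ⇒ x ⊗ w) ∈ F → ∀ k → (w ⇒ x ^ k ⊗ w) ∈ F
  ⇒-⊗-iterate-∈ {x} {w} step zero = ≤⇒⇒∈ (≤-reflexive (sym (⊗-identityˡ w)))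
  ⇒-⊗-iterate-∈ {x} {w} step (suc k) =
    subst (λ u → (w ⇒ u) ∈ F) x⊗[x^k⊗w]≡x^[1+k]⊗w
      (⇒-trans-∈ step (up-closed (⇒-⊗-monoˡ x) (⇒-⊗-iterate-∈ step k)))
    where
    x⊗[x^k⊗w]≡x^[1+k]⊗w : x ⊗ (x ^ k ⊗ w) ≡ x ^ suc k ⊗ w
    x⊗[x^k⊗w]≡x^[1+k]⊗w = trans (sym (⊗-assoc x (x ^ k) w)) (cong (_⊗ w) (sym (^-suc x k)))

  ⇒-modus-ponens-∈ : ∀ {w y z} → (w ⇒ w ⊗ w) ∈ F →
    (w ⇒ (y ⇒ z)) ∈ F → (w ⇒ y) ∈ F → (w ⇒ z) ∈ F
  ⇒-modus-ponens-∈ w⇒w²∈F w⇒[y⇒z]∈F w⇒y∈F =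
    ⇒-trans-∈ w⇒w²∈F (up-closed ⇒-contract (⊗-closed w⇒[y⇒z]∈F w⇒y∈F))

  PositiveImplicativeLaw : ℕ → Set (a ⊔ ℓ)
  PositiveImplicativeLaw n = ∀ y z → ((y ^ n ⇒ z) ⇒ y) ∈ F → y ∈ F

  positiveImplicative⇔law : ∀ n → IsNFoldPositiveImplicative L n F ⇔ PositiveImplicativeLaw n
  positiveImplicative⇔law n = mk⇔
    (λ (_ , pi) y z c∈F → pi _ y z (≤⇒⇒∈ ≤-refl) c∈F)
    (λ law → 𝟙∈F , λ x y z x⇒c∈F x∈F → law y z (modus-ponens x∈F x⇒c∈F))

  module _ (n : ℕ) (law : PositiveImplicativeLaw n) where

    ^-⇒-⊗-∈ : ∀ x → (x ^ n ⇒ x ⊗ x ^ n) ∈ F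
    ^-⇒-⊗-∈ x = law y 𝟘 (≤⇒⇒∈ (curry (begin
      (y ^ n ⇒ 𝟘) ⊗ x ^ n  ≤⟨ ⊗-monoˡ-≤ (x ^ n) (⇒-antitoneˡ 𝟘 (^-mono-≤ n x≤y)) ⟩
      (x ^ n ⇒ 𝟘) ⊗ x ^ n  ≤⟨ eval ⟩
      𝟘                    ≤⟨ 𝟘-≤ ⟩
      x ⊗ x ^ n            ∎)))
      where
      y = x ^ n ⇒ x ⊗ x ^ n
      x≤y : x ≤ y
      x≤y = curry ≤-refl

    law⇒implicative : IsNFoldImplicative L n F
    law⇒implicative = 𝟙∈F , λ x y z →
      ⇒-modus-ponens-∈ (⇒-⊗-iterate-∈ (^-⇒-⊗-∈ x) n)

    law⇒fantastic : IsNFoldFantastic L n F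
    law⇒fantastic = 𝟙∈F , fantastic
      where
      fantastic : ∀ x y → (y ⇒ x) ∈ F → (((x ^ n ⇒ y) ⇒ y) ⇒ x) ∈ F
      fantastic x y y⇒x∈F = law w y (modus-ponens y⇒x∈F (≤⇒⇒∈ (curry (curry bound))))
        where
        q = (x ^ n ⇒ y) ⇒ y
        w = q ⇒ x
        bound : ((y ⇒ x) ⊗ (w ^ n ⇒ y)) ⊗ q ≤ x
        bound = begin
          ((y ⇒ x) ⊗ (w ^ n ⇒ y)) ⊗ q  ≡⟨ xy∙z≈x∙zy (y ⇒ x) (w ^ n ⇒ y) q ⟩
          (y ⇒ x) ⊗ (q ⊗ (w ^ n ⇒ y))  ≤⟨ ⊗-monoʳ-≤ (y ⇒ x)
                                            (⊗-monoʳ-≤ q (⇒-antitoneˡ y (^-mono-≤ n ≤-⇒))) ⟩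
          (y ⇒ x) ⊗ (q ⊗ (x ^ n ⇒ y))  ≤⟨ ⊗-monoʳ-≤ (y ⇒ x) eval ⟩
          (y ⇒ x) ⊗ y                  ≤⟨ eval ⟩
          x                            ∎

  fantastic×implicative⇒law : ∀ n → IsNFoldFantastic L n F → IsNFoldImplicative L n F →
    PositiveImplicativeLaw n
  fantastic×implicative⇒law n (_ , fantastic) (_ , implicative) y z c∈F =
    modus-ponens t⇒s∈F (fantastic y s c∈F)
    where
    s = y ^ n ⇒ z
    t = y ^ n ⇒ s
    y^n⇒[y^n⇒[t⇒z]]∈F : (y ^ n ⇒ (y ^ n ⇒ (t ⇒ z))) ∈ F
    -- up to exchanging premises this is t ⇒ t
    y^n⇒[y^n⇒[t⇒z]]∈F =
      up-closed (≤-trans ⇒-exchange (⇒-monotoneʳ (y ^ n) ⇒-exchange)) (≤⇒⇒∈ ≤-refl)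
    t⇒s∈F : (t ⇒ s) ∈ F
    t⇒s∈F = up-closed ⇒-exchange (implicative y (y ^ n) (t ⇒ z) y^n⇒[y^n⇒[t⇒z]]∈F (≤⇒⇒∈ ≤-refl))

theorem7p8 : {a ℓ : Level} (L : ResiduatedLattice a) (n : ℕ) → n ≥ 1 →
    (F : Pred (ResiduatedLattice.Carrier L) ℓ) → IsFilter L F →
    IsNFoldPositiveImplicative L n F ⇔ (IsNFoldFantastic L n F × IsNFoldImplicative L n F)
theorem7p8 L n _ F isFilter = mk⇔
  (λ pi → let law = to pi in law⇒fantastic n law , law⇒implicative n law)
  (λ (fantastic , implicative) → from (fantastic×implicative⇒law n fantastic implicative))
  where
  open FilterProperties L isFilter
  open Equivalence (positiveImplicative⇔law n)
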